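{- For each prime $p$ and each positive integer $\alpha$, the zero-divisor graph $\Gamma(\mathbb{Z}_{p^{\alpha}})$ is a connected threshold graph.
   Context: For a finite commutative ring $R$ with unity, the zero-divisor graph $\Gamma(R)$ is the simple graph whose vertex set is all of $R$, two distinct vertices $x,y\in R$ being adjacent if and only if $xy=0$ in $R$. A graph is a threshold graph if it can be obtained from the one-vertex graph $K_1$ by repeatedly (any number of times, in any order) adding either an isolated vertex or a dominating vertex (a new vertex adjacent to all existing vertices). -}

module Defs where

open import Data.Nat using (ℕ; zero; suc; _*_; _<_)
open import Data.Nat.Divisibility using (_∣_)
open import Data.Fin using (Fin; zero; suc; toℕ)
open import Data.Bool using (Bool; false; T)
open import Data.Vec using (Vec; lookup)
open import Data.Product using (Σ; _×_; _,_)
open import Data.Sum using (_⊎_)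
open import Relation.Nullary using (¬_)
open import Relation.Binary.PropositionalEquality using (_≡_)
open import Function.Bundles using (_↔_; _⇔_; Inverse)

Graph : ℕ → Set₁
Graph m = Fin m → Fin m → Set

-- The ring Z_n is modelled with carrier Fin n = {0,…,n-1}; x*y = 0 in Z_n
-- iff n divides the natural-number product.
ZDG : (n : ℕ) → Graph n
ZDG n x y = ¬ (x ≡ y) × (n ∣ toℕ x * toℕ y)

data Walk {m : ℕ} (G : Graph m) : Fin m → Fin m → Set where
  here : ∀ {x} → Walk G x x
  step : ∀ {x y z} → G x y → Walk G y z → Walk G x z

Connected : {m : ℕ} → Graph m → Set
Connected {m} G = (x y : Fin m) → Walk G x y

-- Threshold graph construction: start from K₁ (vertex 0); vertex i+1 is
-- added as a dominating vertex if bs[i] = true, as an isolated vertex otherwise.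
-- The resulting graph lives on Fin (suc k).
isDom : ∀ {k} → Vec Bool k → Fin (suc k) → Bool
isDom bs zero    = false
isDom bs (suc i) = lookup bs i

BuiltAdj : ∀ {k} → Vec Bool k → Graph (suc k)
BuiltAdj bs i j = (toℕ i < toℕ j × T (isDom bs j)) ⊎ (toℕ j < toℕ i × T (isDom bs i))

IsThreshold : {m : ℕ} → Graph m → Set
IsThreshold {m} G =
  Σ ℕ λ k → Σ (Vec Bool k) λ bs → Σ (Fin (suc k) ↔ Fin m) λ f →
    (i j : Fin (suc k)) → G (Inverse.to f i) (Inverse.to f j) ⇔ BuiltAdj bs i j

-- In ℤ_{p^α} one has x y = 0 exactly when v x + v y ≥ α, where v is the
-- p-adic valuation capped at α, so adjacency in Γ depends only on
-- valuations. Call a vertex high when 2 v ≥ α and low otherwise, and list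
-- the vertices by increasing key 2 v + 1 (high) resp. 2 (α - v) (low).
-- Then a high vertex is adjacent to every vertex before it and a low vertex
-- to none of them, so Γ is built by adding dominating and isolated
-- vertices in this order. Connectivity holds because 0 is adjacent to all
-- other vertices.
module Submission where

open import Data.Bool using (Bool; T)
open import Data.Empty using (⊥-elim)
open import Data.Fin as Fin using (Fin; zero; suc; toℕ; punchIn)
open import Data.Fin.Permutation using (Permutation′; id; insert; insert-punchIn; _⟨$⟩ʳ_)
import Data.Fin.Properties as Fin
open import Data.List using (allFin)
open import Data.List.Extrema.Nat using (argmin; f[argmin]≤f[xs])
open import Data.List.Membership.Propositional.Properties using (∈-allFin)
import Data.List.Relation.Unary.All as All
open import Data.Nat
open import Data.Nat.Divisibility
open import Data.Nat.Primality using (Prime; euclidsLemma; prime⇒nonZero)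
open import Data.Nat.Properties
open import Data.Product using (Σ; _×_; _,_; proj₁; proj₂)
open import Data.Sum as Sum using (inj₁; inj₂)
open import Data.Unit using (tt)
open import Data.Vec using (Vec; tabulate)
open import Data.Vec.Properties using (lookup∘tabulate)
open import Defs
open import Function using (_∘_; const)
open import Function.Bundles using (_⇔_; mk⇔; Equivalence; Injection)
open import Function.Properties.Equivalence using (⇔-setoid)
open import Function.Properties.Inverse using (↔⇒↣)
open import Level using (0ℓ)
open import Relation.Binary.Definitions using (Symmetric; Irreflexive; tri<; tri≈; tri>)
open import Relation.Binary.PropositionalEquality
open import Relation.Nullary using (¬_; yes; no; contradiction)
open import Relation.Nullary.Decidable using (isYes)
import Relation.Binary.Reasoning.Setoid as SetoidReasoning

module ⇔-Reasoning = SetoidReasoning (⇔-setoid 0ℓ)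

universal⇒connected : ∀ {m} {G : Graph m} → Symmetric G →
  (z : Fin m) → (∀ x → x ≢ z → G x z) → Connected G
universal⇒connected {G = G} G-sym z z~ x y with x Fin.≟ z | y Fin.≟ z
... | yes refl | yes refl = here
... | yes refl | no y≢z   = step (G-sym (z~ y y≢z)) here
... | no x≢z   | yes refl = step (z~ x x≢z) here
... | no x≢z   | no y≢z   = step (z~ x x≢z) (step (G-sym (z~ y y≢z)) here)

Fin-argmin : ∀ {n} (key : Fin (suc n) → ℕ) → Σ (Fin (suc n)) λ i → ∀ j → key i ≤ key j
Fin-argmin {n} key =
  argmin key zero (allFin (suc n)) ,
  λ j → All.lookup (f[argmin]≤f[xs] {f = key} zero (allFin (suc n))) (∈-allFin j)

sortingPermutation : ∀ {n} (key : Fin n → ℕ) →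
  Σ (Permutation′ n) λ π → ∀ {i j} → i Fin.< j → key (π ⟨$⟩ʳ i) ≤ key (π ⟨$⟩ʳ j)
sortingPermutation {zero} key = id , λ { {()} }
sortingPermutation {suc n} key = insert zero i π , monotone
  where
  i : Fin (suc n)
  i = proj₁ (Fin-argmin key)
  i-minimal : ∀ j → key i ≤ key j
  i-minimal = proj₂ (Fin-argmin key)
  π : Permutation′ n
  π = proj₁ (sortingPermutation (key ∘ punchIn i))
  π-monotone : ∀ {a b} → a Fin.< b → key (punchIn i (π ⟨$⟩ʳ a)) ≤ key (punchIn i (π ⟨$⟩ʳ b))
  π-monotone = proj₂ (sortingPermutation (key ∘ punchIn i))

  monotone : ∀ {a b} → a Fin.< b → key (insert zero i π ⟨$⟩ʳ a) ≤ key (insert zero i π ⟨$⟩ʳ b)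
  monotone {zero}  {suc b} _ = i-minimal _
  monotone {suc a} {suc b} a<b
    rewrite insert-punchIn zero i π a | insert-punchIn zero i π b = π-monotone (s<s⁻¹ a<b)

module _ {k} (bs : Vec Bool k) where

  BuiltAdj-irrefl : ∀ i → ¬ BuiltAdj bs i i
  BuiltAdj-irrefl i (inj₁ (i<i , _)) = <-irrefl refl i<i
  BuiltAdj-irrefl i (inj₂ (i<i , _)) = <-irrefl refl i<i

  BuiltAdj-sym : Symmetric (BuiltAdj bs)
  BuiltAdj-sym = Sum.swap

  BuiltAdj-< : ∀ {i j} → i Fin.< j → BuiltAdj bs i j ⇔ T (isDom bs j)
  BuiltAdj-< {i} {j} i<j = mk⇔ later (λ d → inj₁ (i<j , d))
    where
    later : BuiltAdj bs i j → T (isDom bs j)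
    later (inj₁ (_ , d))   = d
    later (inj₂ (j<i , _)) = contradiction i<j (<-asym j<i)

threshold-by-key : ∀ {n} → 0 < n → (G : Graph n) → Irreflexive _≡_ G → Symmetric G →
  (key : Fin n → ℕ) (dom : Fin n → Bool) →
  (∀ {x y} → x ≢ y → key x ≤ key y → G x y ⇔ T (dom y)) →
  IsThreshold G
threshold-by-key {suc k} _ G G-irrefl G-sym key dom decided = k , bs , π , adjacency
  where
  π : Permutation′ (suc k)
  π = proj₁ (sortingPermutation key)
  v : Fin (suc k) → Fin (suc k)
  v = π ⟨$⟩ʳ_
  π-monotone : ∀ {i j} → i Fin.< j → key (v i) ≤ key (v j)
  π-monotone = proj₂ (sortingPermutation key)
  bs : Vec Bool k
  bs = tabulate (dom ∘ v ∘ suc)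

  v-distinct : ∀ {i j} → i ≢ j → v i ≢ v j
  v-distinct i≢j = i≢j ∘ Injection.injective (↔⇒↣ π)

  forward : ∀ {i j} → i Fin.< j → G (v i) (v j) ⇔ BuiltAdj bs i j
  forward {i} {suc j} i<j = begin
    G (v i) (v (suc j))     ≈⟨ decided (v-distinct (Fin.<⇒≢ i<j)) (π-monotone i<j) ⟩
    T (dom (v (suc j)))     ≡⟨ cong T (lookup∘tabulate (dom ∘ v ∘ suc) j) ⟨
    T (isDom bs (suc j))    ≈⟨ BuiltAdj-< bs i<j ⟨
    BuiltAdj bs i (suc j)   ∎
    where open ⇔-Reasoning

  adjacency : ∀ i j → G (v i) (v j) ⇔ BuiltAdj bs i j
  adjacency i j with Fin.<-cmp i j
  ... | tri< i<j _ _ = forward i<j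
  ... | tri≈ _ refl _ = mk⇔ (⊥-elim ∘ G-irrefl refl) (⊥-elim ∘ BuiltAdj-irrefl bs i)
  ... | tri> _ _ j<i = mk⇔ (BuiltAdj-sym bs ∘ Equivalence.to (forward j<i) ∘ G-sym)
                           (G-sym ∘ Equivalence.from (forward j<i) ∘ BuiltAdj-sym bs)

^-monoʳ-∣ : ∀ p {m n} → m ≤ n → p ^ m ∣ p ^ n
^-monoʳ-∣ p {m} {n} m≤n = divides (p ^ (n ∸ m)) (begin
  p ^ n             ≡⟨ cong (p ^_) (sym (m∸n+n≡m m≤n)) ⟩
  p ^ (n ∸ m + m)   ≡⟨ ^-distribˡ-+-* p (n ∸ m) m ⟩
  p ^ (n ∸ m) * p ^ m ∎)
  where open ≡-Reasoning

-- valuation p c x is the exponent of p in x, capped at c; the cap is what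
-- makes it total, with valuation p c 0 ≡ c.
valuation : ℕ → ℕ → ℕ → ℕ
valuation p zero    x = 0
valuation p (suc c) x with p ∣? x
... | yes p∣x = suc (valuation p c (quotient p∣x))
... | no  _   = 0

^valuation∣ : ∀ p c x → p ^ valuation p c x ∣ x
^valuation∣ p zero    x = 1∣ x
^valuation∣ p (suc c) x with p ∣? x
... | yes p∣x = subst (p * p ^ valuation p c (quotient p∣x) ∣_) (sym (m∣n⇒n≡m*quotient p∣x))
                  (*-monoʳ-∣ p (^valuation∣ p c (quotient p∣x)))
... | no  _   = 1∣ x

valuation<cap⇒coprime-part : ∀ p c x → valuation p c x < c →
  Σ ℕ λ a → x ≡ p ^ valuation p c x * a × ¬ p ∣ a
valuation<cap⇒coprime-part p (suc c) x v<c with p ∣? x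
... | no  p∤x = x , sym (*-identityˡ x) , p∤x
... | yes p∣x with valuation<cap⇒coprime-part p c (quotient p∣x) (s<s⁻¹ v<c)
...   | a , q≡ , p∤a = a , (begin
        x                                          ≡⟨ m∣n⇒n≡m*quotient p∣x ⟩
        p * quotient p∣x                           ≡⟨ cong (p *_) q≡ ⟩
        p * (p ^ valuation p c (quotient p∣x) * a) ≡⟨ *-assoc p _ a ⟨
        p * p ^ valuation p c (quotient p∣x) * a   ∎) , p∤a
  where open ≡-Reasoning

module _ {p} (p-prime : Prime p) (α : ℕ) where

  private instance
    p≢0 : NonZero p
    p≢0 = prime⇒nonZero p-prime

  ^∣*⇔≤valuation+valuation : ∀ x y →
    p ^ α ∣ x * y ⇔ α ≤ valuation p α x + valuation p α y
  ^∣*⇔≤valuation+valuation x y = mk⇔ necessary sufficient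
    where
    vx vy : ℕ
    vx = valuation p α x
    vy = valuation p α y

    sufficient : α ≤ vx + vy → p ^ α ∣ x * y
    sufficient α≤ = ∣-trans (^-monoʳ-∣ p α≤)
      (subst (_∣ x * y) (sym (^-distribˡ-+-* p vx vy)) (*-pres-∣ (^valuation∣ p α x) (^valuation∣ p α y)))

    -- Writing x = p^vx a and y = p^vy b with p ∤ a, b, a factor p^(vx+vy+1)
    -- of x y would leave p ∣ a b, contradicting Euclid's lemma.
    insufficient : vx + vy < α → ¬ p ^ α ∣ x * y
    insufficient v<α p^α∣xy
      with valuation<cap⇒coprime-part p α x (≤-<-trans (m≤m+n vx vy) v<α)
         | valuation<cap⇒coprime-part p α y (≤-<-trans (m≤n+m vy vx) v<α)
    ... | a , x≡ , p∤a | b , y≡ , p∤b = Sum.[ p∤a , p∤b ] (euclidsLemma a b p-prime p∣ab)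
      where
      instance
        p^v≢0 : NonZero (p ^ (vx + vy))
        p^v≢0 = m^n≢0 p (vx + vy)
      xy≡ : x * y ≡ p ^ (vx + vy) * (a * b)
      xy≡ = begin
        x * y                         ≡⟨ cong₂ _*_ x≡ y≡ ⟩
        (p ^ vx * a) * (p ^ vy * b)   ≡⟨ [m*n]*[o*p]≡[m*o]*[n*p] (p ^ vx) a (p ^ vy) b ⟩
        (p ^ vx * p ^ vy) * (a * b)   ≡⟨ cong (_* (a * b)) (^-distribˡ-+-* p vx vy) ⟨
        p ^ (vx + vy) * (a * b)       ∎
        where open ≡-Reasoning
      p∣ab : p ∣ a * b
      p∣ab = *-cancelˡ-∣ (p ^ (vx + vy))
        (∣-trans (subst (_∣ p ^ α) (*-comm p _) (^-monoʳ-∣ p v<α))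
                 (subst (p ^ α ∣_) xy≡ p^α∣xy))

    necessary : p ^ α ∣ x * y → α ≤ vx + vy
    necessary p^α∣xy = ≮⇒≥ (λ v<α → insufficient v<α p^α∣xy)

m+m≤1+n+n⇒m≤n : ∀ {m n} → m + m ≤ suc (n + n) → m ≤ n
m+m≤1+n+n⇒m≤n {m} {n} m+m≤ = ≮⇒≥ λ n<m →
  <-irrefl refl (+-cancelˡ-≤ n (suc n) n (s≤s⁻¹ (≤-trans (+-mono-≤ n<m n<m) m+m≤)))

1+m+m≤n+n⇒m<n : ∀ {m n} → suc (m + m) ≤ n + n → m < n
1+m+m≤n+n⇒m<n 1+m+m≤ = ≰⇒> λ n≤m → <⇒≱ 1+m+m≤ (+-mono-≤ n≤m n≤m)

module _ (α : ℕ) where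

  isHigh : ℕ → Bool
  isHigh w = isYes (α ≤? w + w)

  -- Orders low values w by decreasing w and places them just before the high
  -- values v ≥ α - w; odd keys for high values break ties in favour of the low ones.
  rank : ℕ → ℕ
  rank w with α ≤? w + w
  ... | yes _ = suc (w + w)
  ... | no  _ = (α ∸ w) + (α ∸ w)

  rank≤⇒≤+⇔isHigh : ∀ x y → rank x ≤ rank y → α ≤ x + y ⇔ T (isHigh y)
  rank≤⇒≤+⇔isHigh x y r with α ≤? y + y | α ≤? x + x
  ... | yes α≤y+y | yes α≤x+x = mk⇔ (const tt) (const (both-high α≤x+x α≤y+y))
    where
    both-high : α ≤ x + x → α ≤ y + y → α ≤ x + y
    both-high α≤x+x α≤y+y with ≤-total x y
    ... | inj₁ x≤y = ≤-trans α≤x+x (+-monoʳ-≤ x x≤y)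
    ... | inj₂ y≤x = ≤-trans α≤y+y (+-monoˡ-≤ y y≤x)
  ... | yes _     | no  _     = mk⇔ (const tt) (const α≤x+y)
    where
    α≤x+y : α ≤ x + y
    α≤x+y = ≤-trans (m≤n+m∸n α x) (+-monoʳ-≤ x (m+m≤1+n+n⇒m≤n r))
  ... | no  α≰y+y | yes _     = mk⇔ (<⇒≱ x+y<α) λ ()
    where
    y≤α : y ≤ α
    y≤α = m+n≤o⇒n≤o y (<⇒≤ (≰⇒> α≰y+y))
    x+y<α : x + y < α
    x+y<α = m≤o∸n⇒m+n≤o (suc x) y≤α (1+m+m≤n+n⇒m<n r)
  ... | no  α≰y+y | no  α≰x+x = mk⇔ (<⇒≱ (both-low (≰⇒> α≰x+x) (≰⇒> α≰y+y))) λ ()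
    where
    both-low : x + x < α → y + y < α → x + y < α
    both-low x+x<α y+y<α with ≤-total x y
    ... | inj₁ x≤y = ≤-<-trans (+-monoˡ-≤ y x≤y) y+y<α
    ... | inj₂ y≤x = ≤-<-trans (+-monoʳ-≤ x y≤x) x+x<α

module _ (n : ℕ) where

  ZDG-irrefl : Irreflexive _≡_ (ZDG n)
  ZDG-irrefl x≡y (x≢y , _) = x≢y x≡y

  ZDG-sym : Symmetric (ZDG n)
  ZDG-sym {x} {y} (x≢y , n∣xy) = x≢y ∘ sym , subst (n ∣_) (*-comm (toℕ x) (toℕ y)) n∣xy

  ZDG-zero : ∀ z → toℕ z ≡ 0 → ∀ x → x ≢ z → ZDG n x z
  ZDG-zero z z≡0 x x≢z = x≢z , subst (n ∣_) (sym (trans (cong (toℕ x *_) z≡0) (*-zeroʳ (toℕ x)))) (n ∣0)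

mainTheorem6 : (p α : ℕ) → Prime p → 1 ≤ α →
    Connected (ZDG (p ^ α)) × IsThreshold (ZDG (p ^ α))
mainTheorem6 p α p-prime _ =
  universal⇒connected (ZDG-sym n) zero′ (ZDG-zero n zero′ (Fin.toℕ-fromℕ< 0<n)) ,
  threshold-by-key 0<n (ZDG n) (ZDG-irrefl n) (ZDG-sym n) (rank α ∘ v) (isHigh α ∘ v) decided
  where
  instance
    p≢0 : NonZero p
    p≢0 = prime⇒nonZero p-prime
  n : ℕ
  n = p ^ α
  0<n : 0 < n
  0<n = m^n>0 p α
  zero′ : Fin n
  zero′ = Fin.fromℕ< 0<n
  v : Fin n → ℕ
  v x = valuation p α (toℕ x)
  decided : ∀ {x y} → x ≢ y → rank α (v x) ≤ rank α (v y) → ZDG n x y ⇔ T (isHigh α (v y))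
  decided {x} {y} x≢y r = begin
    ZDG n x y          ≈⟨ mk⇔ proj₂ (x≢y ,_) ⟩
    n ∣ toℕ x * toℕ y  ≈⟨ ^∣*⇔≤valuation+valuation p-prime α (toℕ x) (toℕ y) ⟩
    α ≤ v x + v y      ≈⟨ rank≤⇒≤+⇔isHigh α (v x) (v y) r ⟩
    T (isHigh α (v y)) ∎
    where open ⇔-Reasoning
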